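{- For any finite abelian group $G$ and integer $k\ge1$, we have $\mathbf{t}^+_{k+1}(G)=\mathcal{N}_k(G)$, except when $|G|$ is prime and $k\ge|G|-1$, in which case $\mathbf{t}^+_{k+1}(G)=0$ and $\mathcal{N}_k(G)=1$.
   Context: Let $G$ be a finite abelian group, written additively. For $A\subseteq G$ and integer $k\ge1$, $kA:=\{a_1+\dots+a_k\colon a_i\in A\}$. The period of $A$ is $\pi(A):=\{g\in G\colon A+g=A\}$; $A$ is aperiodic if $\pi(A)=\{0\}$. $\mathcal{N}_k(G)$ is the largest size of an aperiodic subset $A\subseteq G$ with $kA\ne G$ and $k(A\cup\{g\})=G$ for every $g\in G\setminus A$ (with $\max\emptyset=0$). For an integer $\rho\ge1$, $\mathbf{t}^+_\rho(G)$ is the largest size of an aperiodic generating subset $A\subseteq G$ such that $(\rho-1)(A\cup\{0\})\ne G$ and $A$ is maximal under this condition, i.e. $(\rho-1)(A\cup\{0\}\cup\{g\})=G$ for every $g\in G\setminus A$ (with $\max\emptyset=0$). -}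

module Defs where

open import Data.Nat using (ℕ; zero; suc; _≤_)
open import Data.Fin using (Fin)
open import Data.Fin.Subset using (Subset; _∈_; _∉_; _∪_; ⁅_⁆; ∣_∣)
open import Data.Product using (Σ; ∃; ∃-syntax; _×_; _,_)
open import Data.Sum using (_⊎_)
open import Relation.Nullary using (¬_)
open import Relation.Binary.PropositionalEquality using (_≡_)
open import Algebra.Core using (Op₁; Op₂)
open import Algebra.Structures using (IsAbelianGroup)

-- A finite abelian group of order n, with carrier Fin n
-- (every finite abelian group is isomorphic to one of this form).
record FinAbGroup (n : ℕ) : Set where
  infixl 7 _∙_
  field
    _∙_ : Op₂ (Fin n)
    ε   : Fin n
    _⁻¹ : Op₁ (Fin n)
    isAbelianGroup : IsAbelianGroup _≡_ _∙_ ε _⁻¹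

module _ {n : ℕ} (G : FinAbGroup n) where
  open FinAbGroup G

  -- x ∈ kA  (with 0A = {0}), so (suc k)A = A + kA
  InMul : ℕ → Subset n → Fin n → Set
  InMul zero    A x = x ≡ ε
  InMul (suc k) A x = ∃[ a ] ∃[ y ] (a ∈ A × InMul k A y × x ≡ a ∙ y)

  MulFull : ℕ → Subset n → Set
  MulFull k A = ∀ x → InMul k A x

  InTranslate : Subset n → Fin n → Fin n → Set
  InTranslate A g x = ∃[ a ] (a ∈ A × x ≡ a ∙ g)

  InPeriod : Subset n → Fin n → Set
  InPeriod A g = ∀ x → (InTranslate A g x → x ∈ A) × (x ∈ A → InTranslate A g x)

  Aperiodic : Subset n → Set
  Aperiodic A = ∀ g → InPeriod A g → g ≡ ε

  data InGen (A : Subset n) : Fin n → Set where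
    gen-ε   : InGen A ε
    gen-el  : ∀ {a} → a ∈ A → InGen A a
    gen-inv : ∀ {x} → InGen A x → InGen A (x ⁻¹)
    gen-op  : ∀ {x y} → InGen A x → InGen A y → InGen A (x ∙ y)

  Generating : Subset n → Set
  Generating A = ∀ x → InGen A x

  NCond : ℕ → Subset n → Set
  NCond k A = Aperiodic A × ¬ MulFull k A
            × (∀ g → g ∉ A → MulFull k (A ∪ ⁅ g ⁆))

  TCond : ℕ → Subset n → Set
  TCond ρ A = Aperiodic A × Generating A
            × ¬ MulFull (ρ Data.Nat.∸ 1) (A ∪ ⁅ ε ⁆)
            × (∀ g → g ∉ A → MulFull (ρ Data.Nat.∸ 1) ((A ∪ ⁅ ε ⁆) ∪ ⁅ g ⁆))

-- m is the largest size of a subset satisfying P (with max ∅ = 0)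
IsLargest : {n : ℕ} → (Subset n → Set) → ℕ → Set
IsLargest {n} P m =
  ((∃[ A ] (P A × ∣ A ∣ ≡ m)) ⊎ ((∀ A → ¬ P A) × m ≡ 0))
  × (∀ A → P A → ∣ A ∣ ≤ m)

{-# OPTIONS --safe #-}

-- A T-set (for ρ = k + 1) contains 0: otherwise its maximality at g = 0 would give k(A ∪ {0}) = G.
-- So T-sets are generating N-sets containing 0, and t ≤ N. Conversely, an N-set translated to
-- contain 0 is again an N-set of the same size, and it generates G unless it is a subgroup. An
-- aperiodic subgroup is {0}, and {0} is a maximal set with k{0} ≠ G only if every g ≠ 0 satisfies
-- {0, g, …, kg} = G, i.e. only if |G| is prime and k ≥ |G| − 1. In that exceptional case any set
-- containing 0 and some g ≠ 0 already has kA = G, so there is no T-set and the N-sets have at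
-- most one element, {0} being one of them.

module Submission where

open import Defs
open import Level using (0ℓ)
open import Data.Nat as ℕ using (ℕ; zero; suc; _+_; _*_; _∸_; _≤_; _<_; z≤n; s≤s)
import Data.Nat.Properties as ℕP
open import Data.Nat.DivMod using (_%_; _/_; m≡m%n+[m/n]*n; m%n<n)
open import Data.Nat.Divisibility
  using (_∣_; hasNonTrivialDivisor; quotient; m%n≡0⇒n∣m; quotient-<; quotient≢0)
open import Data.Nat.Induction using (<-wellFounded)
open import Data.Nat.Primality using (Prime; prime; prime⇒irreducible; prime⇒nonTrivial)
open import Induction.WellFounded using (Acc; acc)
open import Data.Bool using (Bool; true; false)
open import Data.Fin as F using (Fin; toℕ; fromℕ<)
import Data.Fin.Properties as FP
open import Data.Fin.Subset using (Subset; _∈_; _∉_; _⊆_; _∪_; ⁅_⁆; ∣_∣; ⊤)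
open import Data.Fin.Subset.Properties
  using ( _∈?_; ∈⊤; x∈p∪q⁻; p⊆p∪q; q⊆p∪q; x∈⁅x⁆; x∈⁅y⁆⇒x≡y
        ; p⊆q⇒∣p∣≤∣q∣; ∣⁅x⁆∣≡1; ∣⊥∣≡0; Empty-unique; nonempty?)
open import Data.Vec as V using (lookup; tabulate)
import Data.Vec.Properties as VP
open import Data.Product using (∃-syntax; _×_; _,_; proj₁; proj₂)
open import Data.Sum using (_⊎_; inj₁; inj₂)
open import Data.Empty using (⊥; ⊥-elim)
open import Function using (id; _∘_)
open import Function.Bundles using (mk↔ₛ′)
open import Function.Definitions using (Injective)
open import Data.Fin.Permutation using (Permutation)
open import Relation.Nullary using (¬_; yes; no; contradiction)
open import Relation.Nullary.Decidable using (¬?; _×-dec_; decidable-stable)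
open import Relation.Binary.Definitions using (tri<; tri≈; tri>)
open import Relation.Binary.PropositionalEquality
open import Algebra.Bundles using (AbelianGroup)
import Algebra.Properties.AbelianGroup as AbelianGroupProperties
import Algebra.Properties.CommutativeSemigroup as CommutativeSemigroupProperties
import Algebra.Properties.Monoid.Mult as MonoidMultiplication
import Algebra.Properties.CommutativeMonoid.Sum as CommutativeMonoidSum

module ℕSum = CommutativeMonoidSum ℕP.+-0-commutativeMonoid

injective⇒surjective : ∀ {m} {f : Fin m → Fin m} → Injective _≡_ _≡_ f → ∀ y → ∃[ x ] f x ≡ y
injective⇒surjective {zero} _ ()
injective⇒surjective {suc m} {f} f-inj y with FP.any? (λ x → f x FP.≟ y)
... | yes hit = hit
... | no miss = contradiction (FP.injective⇒≤ punched-inj) (ℕP.<-irrefl refl)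
  where
  punched : Fin (suc m) → Fin m
  punched x = F.punchOut {i = y} {j = f x} (λ y≡fx → miss (x , sym y≡fx))
  punched-inj : Injective _≡_ _≡_ punched
  punched-inj {a} {b} = f-inj ∘ FP.punchOut-injective (λ e → miss (a , sym e)) (λ e → miss (b , sym e))

module _ {n : ℕ} {P : Subset n → Set} {m : ℕ} (largest : IsLargest P m) where

  largest-≤ : ∀ {b} → (∀ A → P A → ∣ A ∣ ≤ b) → m ≤ b
  largest-≤ bound with proj₁ largest
  ... | inj₁ (A , PA , refl) = bound A PA
  ... | inj₂ (_ , refl) = z≤n

  largest-unsatisfiable : (∀ A → ¬ P A) → m ≡ 0
  largest-unsatisfiable none with proj₁ largest
  ... | inj₁ (A , PA , _) = ⊥-elim (none A PA)
  ... | inj₂ (_ , m≡0) = m≡0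

bound-if-nonempty : ∀ {n b} {A : Subset n} → (∀ {a} → a ∈ A → ∣ A ∣ ≤ b) → ∣ A ∣ ≤ b
bound-if-nonempty {n} {A = A} bound with nonempty? A
... | yes (a , a∈A) = bound a∈A
... | no empty = subst (_≤ _) (sym (trans (cong ∣_∣ (Empty-unique empty)) (∣⊥∣≡0 n))) z≤n

indicator : Bool → ℕ
indicator true = 1
indicator false = 0

∣p∣≡∑indicator : ∀ {m} (p : Subset m) →
                 ∣ p ∣ ≡ ℕSum.sum (indicator ∘ lookup p)
∣p∣≡∑indicator V.[] = refl
∣p∣≡∑indicator (true V.∷ p) = cong suc (∣p∣≡∑indicator p)
∣p∣≡∑indicator (false V.∷ p) = ∣p∣≡∑indicator p

module _ {m : ℕ} where

  ∪-least : {p q r : Subset m} → p ⊆ r → q ⊆ r → p ∪ q ⊆ r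
  ∪-least {p} {q} p⊆r q⊆r x∈p∪q with x∈p∪q⁻ p q x∈p∪q
  ... | inj₁ x∈p = p⊆r x∈p
  ... | inj₂ x∈q = q⊆r x∈q

  ∪-monoˡ-⊆ : {p p′ q : Subset m} → p ⊆ p′ → p ∪ q ⊆ p′ ∪ q
  ∪-monoˡ-⊆ {p′ = p′} {q} p⊆p′ = ∪-least (p⊆p∪q q ∘ p⊆p′) (q⊆p∪q p′ q)

  x∈p⇒⁅x⁆⊆p : ∀ {x} {p : Subset m} → x ∈ p → ⁅ x ⁆ ⊆ p
  x∈p⇒⁅x⁆⊆p {x} {p} x∈p y∈⁅x⁆ = subst (_∈ p) (sym (x∈⁅y⁆⇒x≡y x y∈⁅x⁆)) x∈p

module Properties {n : ℕ} (G : FinAbGroup n) where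
  open FinAbGroup G

  abelianGroup : AbelianGroup 0ℓ 0ℓ
  abelianGroup = record
    { Carrier = Fin n ; _≈_ = _≡_ ; _∙_ = _∙_ ; ε = ε ; _⁻¹ = _⁻¹ ; isAbelianGroup = isAbelianGroup }

  open AbelianGroup abelianGroup
    using (comm; identityˡ; identityʳ; _-_; monoid; commutativeMonoid; commutativeSemigroup)
  open AbelianGroupProperties abelianGroup
    using (∙-cancelʳ; ⁻¹-involutive; ε⁻¹≈ε; //-rightDividesˡ; //-rightDividesʳ)
  open CommutativeSemigroupProperties commutativeSemigroup using (interchange; xy∙z≈xz∙y)
  open MonoidMultiplication monoid using (×-homo-+; ×-homo-1; ×-assocˡ) renaming (_×_ to _·_)
  open CommutativeMonoidSum commutativeMonoid
    using (sum; ∑-distrib-+; sum-permute; sum-replicate; sum-replicate-zero)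
  open ≡-Reasoning

  -- Multiples and element orders

  ·-ε : ∀ j → j · ε ≡ ε
  ·-ε j = trans (sym (sum-replicate j)) (sum-replicate-zero j)

  translation : Fin n → Permutation n n
  translation a = mk↔ₛ′ (_∙ a) (_- a) (//-rightDividesˡ a) (//-rightDividesʳ a)

  n·g≡ε : ∀ g → n · g ≡ ε
  n·g≡ε g = ∙-cancelʳ Σ (n · g) ε (begin
    n · g ∙ Σ             ≡⟨ comm (n · g) Σ ⟩
    Σ ∙ n · g             ≡⟨ cong (Σ ∙_) (sum-replicate n) ⟨
    Σ ∙ sum {n} (λ _ → g) ≡⟨ ∑-distrib-+ id (λ _ → g) ⟨
    sum {n} (λ x → x ∙ g) ≡⟨ sum-permute id (translation g) ⟨
    Σ                     ≡⟨ identityˡ Σ ⟨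
    ε ∙ Σ                 ∎)
    where Σ = sum {n} id

  0<n : 0 < n
  0<n = ℕP.≤-<-trans z≤n (FP.toℕ<n ε)

  record IsOrder (g : Fin n) (o : ℕ) : Set where
    field
      positive    : 0 < o
      annihilates : o · g ≡ ε
      minimal     : ∀ {j} → 0 < j → j < o → j · g ≢ ε

  order-below : ∀ {g m} → Acc _<_ m → 0 < m → m · g ≡ ε → ∃[ o ] (o ≤ m × IsOrder g o)
  order-below {g} {m} (acc smaller) 0<m m·g≡ε
    with FP.any? {n = m} (λ j → (0 ℕ.<? toℕ j) ×-dec (toℕ j · g FP.≟ ε))
  ... | yes (j , 0<j , j·g≡ε) =
    let o , o≤j , isOrder = order-below (smaller (FP.toℕ<n j)) 0<j j·g≡ε
    in o , ℕP.≤-trans o≤j (ℕP.<⇒≤ (FP.toℕ<n j)) , isOrder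
  ... | no none = m , ℕP.≤-refl , record
    { positive = 0<m ; annihilates = m·g≡ε
    ; minimal = λ {j} 0<j j<m j·g≡ε → none (fromℕ< j<m ,
        subst (λ i → 0 < i × i · g ≡ ε) (sym (FP.toℕ-fromℕ< j<m)) (0<j , j·g≡ε)) }

  order : ∀ g → ∃[ o ] (o ≤ n × IsOrder g o)
  order g = order-below (<-wellFounded n) 0<n (n·g≡ε g)

  module Order {g o} (isOrder : IsOrder g o) where
    open IsOrder isOrder
    instance
      o≢0 : ℕ.NonZero o
      o≢0 = ℕ.>-nonZero positive

    ·-mod : ∀ j → j · g ≡ (j % o) · g
    ·-mod j = begin
      j · g                                 ≡⟨ cong (_· g) (m≡m%n+[m/n]*n j o) ⟩
      (j % o + (j / o) * o) · g             ≡⟨ ×-homo-+ g (j % o) ((j / o) * o) ⟩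
      (j % o) · g ∙ ((j / o) * o) · g       ≡⟨ cong ((j % o) · g ∙_) (×-assocˡ g (j / o) o) ⟨
      (j % o) · g ∙ (j / o) · (o · g)       ≡⟨ cong (λ h → (j % o) · g ∙ (j / o) · h) annihilates ⟩
      (j % o) · g ∙ (j / o) · ε             ≡⟨ cong ((j % o) · g ∙_) (·-ε (j / o)) ⟩
      (j % o) · g ∙ ε                       ≡⟨ identityʳ _ ⟩
      (j % o) · g                           ∎

    o∣n : o ∣ n
    o∣n with n % o ℕP.≟ 0
    ... | yes n%o≡0 = m%n≡0⇒n∣m n o n%o≡0
    ... | no n%o≢0 = contradiction (trans (sym (·-mod n)) (n·g≡ε g))
                       (minimal (ℕP.n≢0⇒n>0 n%o≢0) (m%n<n n o))

    ·-injective-< : ∀ {i j} → i < j → j < o → i · g ≢ j · g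
    ·-injective-< {i} {j} i<j j<o i·g≡j·g =
      minimal (ℕP.m<n⇒0<n∸m i<j) (ℕP.≤-<-trans (ℕP.m∸n≤m j i) j<o)
        (∙-cancelʳ (i · g) ((j ∸ i) · g) ε (begin
          (j ∸ i) · g ∙ i · g   ≡⟨ ×-homo-+ g (j ∸ i) i ⟨
          (j ∸ i + i) · g       ≡⟨ cong (_· g) (ℕP.m∸n+n≡m (ℕP.<⇒≤ i<j)) ⟩
          j · g                 ≡⟨ i·g≡j·g ⟨
          i · g                 ≡⟨ identityˡ (i · g) ⟨
          ε ∙ i · g             ∎))

    ·-injective : ∀ {i j} → i < o → j < o → i · g ≡ j · g → i ≡ j
    ·-injective {i} {j} i<o j<o i·g≡j·g with ℕP.<-cmp i j
    ... | tri< i<j _ _ = contradiction i·g≡j·g (·-injective-< i<j j<o)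
    ... | tri≈ _ i≡j _ = i≡j
    ... | tri> _ _ j<i = contradiction (sym i·g≡j·g) (·-injective-< j<i i<o)

  powers-cover⇒n≤ : ∀ {g m} → (∀ x → ∃[ j ] (j < m × x ≡ j · g)) → n ≤ m
  powers-cover⇒n≤ {g} {m} cover = FP.injective⇒≤ {f = exponent} exponent-inj
    where
    exponent : Fin n → Fin m
    exponent x = fromℕ< (proj₁ (proj₂ (cover x)))
    exponent-inj : Injective _≡_ _≡_ exponent
    exponent-inj {x} {y} e with cover x | cover y
    ... | i , i< , x≡i·g | j , j< , y≡j·g = begin
      x      ≡⟨ x≡i·g ⟩
      i · g  ≡⟨ cong (_· g) (trans (sym (FP.toℕ-fromℕ< i<)) (trans (cong toℕ e) (FP.toℕ-fromℕ< j<))) ⟩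
      j · g  ≡⟨ y≡j·g ⟨
      y      ∎

  generator-order : ∀ {g} → (∀ x → ∃[ j ] x ≡ j · g) → IsOrder g n
  generator-order {g} generates with order g
  ... | o , o≤n , isOrder = subst (IsOrder g) (ℕP.≤-antisym o≤n n≤o) isOrder
    where
    open Order isOrder
    n≤o : n ≤ o
    n≤o = powers-cover⇒n≤ λ x →
      let j , x≡j·g = generates x in j % o , m%n<n j o , trans x≡j·g (·-mod j)

  order-n⇒generator : ∀ {g} → IsOrder g n → ∀ x → ∃[ j ] (j < n × x ≡ j · g)
  order-n⇒generator {g} isOrder x =
    let i , i·g≡x = injective⇒surjective power-inj x in toℕ i , FP.toℕ<n i , sym i·g≡x
    where
    power : Fin n → Fin n
    power i = toℕ i · g
    power-inj : Injective _≡_ _≡_ power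
    power-inj = FP.toℕ-injective ∘ Order.·-injective isOrder (FP.toℕ<n _) (FP.toℕ<n _)

  prime⇒generator : Prime n → ∀ {g} → g ≢ ε → ∀ x → ∃[ j ] (j < n × x ≡ j · g)
  prime⇒generator p {g} g≢ε with order g
  ... | o , _ , isOrder with prime⇒irreducible p (Order.o∣n isOrder)
  ...   | inj₂ refl = order-n⇒generator isOrder
  ...   | inj₁ refl = contradiction (trans (sym (×-homo-1 g)) (IsOrder.annihilates isOrder)) g≢ε

  trivial⇒n≤1 : (∀ x → x ≡ ε) → n ≤ 1
  trivial⇒n≤1 trivial =
    FP.injective⇒≤ {f = λ (_ : Fin n) → F.zero {0}} λ _ → trans (trivial _) (sym (trivial _))

  n≤1⇒trivial : n ≤ 1 → ∀ x → x ≡ ε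
  n≤1⇒trivial n≤1 x = FP.toℕ-injective (trans (zero-index x) (sym (zero-index ε)))
    where
    zero-index : ∀ (y : Fin n) → toℕ y ≡ 0
    zero-index y = ℕP.n<1⇒n≡0 (ℕP.<-≤-trans (FP.toℕ<n y) n≤1)

  prime⇒nontrivial : Prime n → ¬ (∀ x → x ≡ ε)
  prime⇒nontrivial p trivial =
    ℕP.<⇒≱ (ℕ.nonTrivial⇒n>1 n {{prime⇒nonTrivial p}}) (trivial⇒n≤1 trivial)

  all-generators⇒prime : ∀ {g₀} → g₀ ≢ ε → (∀ g → g ≢ ε → ∀ x → ∃[ j ] x ≡ j · g) → Prime n
  all-generators⇒prime {g₀} g₀≢ε generates =
    prime {{ℕ.n>1⇒nonTrivial 1<n}} λ (hasNonTrivialDivisor {d} {{d-nonTrivial}} d<n d∣n) →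
      no-proper-divisor (ℕ.nonTrivial⇒n>1 d {{d-nonTrivial}}) d<n d∣n
    where
    1<n : 1 < n
    1<n = ℕP.≰⇒> λ n≤1 → g₀≢ε (n≤1⇒trivial n≤1 g₀)
    -- d · g₀ generates G, yet is annihilated by the proper factor n / d.
    no-proper-divisor : ∀ {d} → 1 < d → d < n → d ∣ n → ⊥
    no-proper-divisor {d} 1<d d<n d∣n =
      IsOrder.minimal (generator-order (generates (d · g₀) d·g₀≢ε)) 0<q q<n q·d·g₀≡ε
      where
      instance
        n≢0 : ℕ.NonZero n
        n≢0 = ℕ.>-nonZero 0<n
      q : ℕ
      q = quotient d∣n
      d·g₀≢ε : d · g₀ ≢ ε
      d·g₀≢ε = IsOrder.minimal (generator-order (generates g₀ g₀≢ε)) (ℕP.<-trans ℕ.z<s 1<d) d<n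
      0<q : 0 < q
      0<q = ℕ.>-nonZero⁻¹ q {{quotient≢0 d∣n}}
      q<n : q < n
      q<n = quotient-< d∣n {{ℕ.n>1⇒nonTrivial 1<d}}
      q·d·g₀≡ε : q · d · g₀ ≡ ε
      q·d·g₀≡ε = begin
        q · d · g₀   ≡⟨ ×-assocˡ g₀ q d ⟩
        (q * d) · g₀ ≡⟨ cong (_· g₀) (_∣_.equality d∣n) ⟨
        n · g₀       ≡⟨ n·g≡ε g₀ ⟩
        ε            ∎

  -- Sumsets

  InMul-mono : ∀ {C D} → C ⊆ D → ∀ k {x} → InMul G k C x → InMul G k D x
  InMul-mono C⊆D zero x≡ε = x≡ε
  InMul-mono C⊆D (suc k) (c , y , c∈C , y∈kC , x≡c∙y) = c , y , C⊆D c∈C , InMul-mono C⊆D k y∈kC , x≡c∙y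

  MulFull-mono : ∀ {C D} → C ⊆ D → ∀ k → MulFull G k C → MulFull G k D
  MulFull-mono C⊆D k full x = InMul-mono C⊆D k (full x)

  InMul-translate : ∀ {C D s} → (∀ {c} → c ∈ C → c ∙ s ∈ D) →
                    ∀ k {x} → InMul G k C x → InMul G k D (x ∙ k · s)
  InMul-translate C+s⊆D zero {x} x≡ε = trans (identityʳ x) x≡ε
  InMul-translate {s = s} C+s⊆D (suc k) {x} (c , y , c∈C , y∈kC , x≡c∙y) =
    c ∙ s , y ∙ k · s , C+s⊆D c∈C , InMul-translate C+s⊆D k y∈kC ,
    trans (cong (_∙ (s ∙ k · s)) x≡c∙y) (interchange c y s (k · s))

  MulFull-translate : ∀ {C D s} → (∀ {c} → c ∈ C → c ∙ s ∈ D) → ∀ k → MulFull G k C → MulFull G k D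
  MulFull-translate {D = D} {s} C+s⊆D k full x =
    subst (InMul G k D) (//-rightDividesˡ (k · s) x) (InMul-translate C+s⊆D k (full (x - k · s)))

  ε∈InMul : ∀ {C} → ε ∈ C → ∀ k → InMul G k C ε
  ε∈InMul ε∈C zero = refl
  ε∈InMul ε∈C (suc k) = ε , ε , ε∈C , ε∈InMul ε∈C k , sym (identityˡ ε)

  ·∈InMul : ∀ {C a} → ε ∈ C → a ∈ C → ∀ {j k} → j ≤ k → InMul G k C (j · a)
  ·∈InMul ε∈C a∈C {zero} {k} _ = ε∈InMul ε∈C k
  ·∈InMul {a = a} ε∈C a∈C {suc j} (s≤s j≤k) = a , j · a , a∈C , ·∈InMul ε∈C a∈C j≤k , refl

  InMul⊆powers : ∀ {C g} → C ⊆ ⁅ ε ⁆ ∪ ⁅ g ⁆ → ∀ k {x} → InMul G k C x → ∃[ j ] (j ≤ k × x ≡ j · g)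
  InMul⊆powers C⊆ zero x≡ε = 0 , z≤n , x≡ε
  InMul⊆powers {g = g} C⊆ (suc k) {x} (c , y , c∈C , y∈kC , x≡c∙y)
    with InMul⊆powers C⊆ k y∈kC | x∈p∪q⁻ ⁅ ε ⁆ ⁅ g ⁆ (C⊆ c∈C)
  ... | j , j≤k , y≡j·g | inj₁ c∈⁅ε⁆ =
    j , ℕP.m≤n⇒m≤1+n j≤k , trans x≡c∙y (trans (cong₂ _∙_ (x∈⁅y⁆⇒x≡y ε c∈⁅ε⁆) y≡j·g) (identityˡ (j · g)))
  ... | j , j≤k , y≡j·g | inj₂ c∈⁅g⁆ =
    suc j , s≤s j≤k , trans x≡c∙y (cong₂ _∙_ (x∈⁅y⁆⇒x≡y g c∈⁅g⁆) y≡j·g)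

  InMul⇒InGen : ∀ {B C} → (∀ {c} → c ∈ C → InGen G B c) → ∀ k {x} → InMul G k C x → InGen G B x
  InMul⇒InGen C⊆⟨B⟩ zero x≡ε = subst (InGen G _) (sym x≡ε) gen-ε
  InMul⇒InGen C⊆⟨B⟩ (suc k) (c , y , c∈C , y∈kC , x≡c∙y) =
    subst (InGen G _) (sym x≡c∙y) (gen-op (C⊆⟨B⟩ c∈C) (InMul⇒InGen C⊆⟨B⟩ k y∈kC))

  InGen-⊆⁅ε⁆ : ∀ {A} → A ⊆ ⁅ ε ⁆ → ∀ {x} → InGen G A x → x ≡ ε
  InGen-⊆⁅ε⁆ A⊆ε gen-ε = refl
  InGen-⊆⁅ε⁆ A⊆ε (gen-el a∈A) = x∈⁅y⁆⇒x≡y ε (A⊆ε a∈A)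
  InGen-⊆⁅ε⁆ A⊆ε (gen-inv x∈⟨A⟩) = trans (cong _⁻¹ (InGen-⊆⁅ε⁆ A⊆ε x∈⟨A⟩)) ε⁻¹≈ε
  InGen-⊆⁅ε⁆ A⊆ε (gen-op x∈⟨A⟩ y∈⟨A⟩) =
    trans (cong₂ _∙_ (InGen-⊆⁅ε⁆ A⊆ε x∈⟨A⟩) (InGen-⊆⁅ε⁆ A⊆ε y∈⟨A⟩)) (identityˡ ε)

  ⊆⁅ε⁆⊎nonidentity : ∀ A → A ⊆ ⁅ ε ⁆ ⊎ ∃[ a ] (a ∈ A × a ≢ ε)
  ⊆⁅ε⁆⊎nonidentity A with FP.any? (λ a → (a ∈? A) ×-dec ¬? (a FP.≟ ε))
  ... | yes found = inj₂ found
  ... | no none = inj₁ λ {a} a∈A →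
    subst (_∈ ⁅ ε ⁆) (sym (decidable-stable (a FP.≟ ε) (λ a≢ε → none (a , a∈A , a≢ε)))) (x∈⁅x⁆ ε)

  difference-closed⊎escape : ∀ B → (∀ {b b′} → b ∈ B → b′ ∈ B → b - b′ ∈ B)
                                  ⊎ ∃[ b ] ∃[ b′ ] (b ∈ B × b′ ∈ B × b - b′ ∉ B)
  difference-closed⊎escape B
    with FP.any? (λ b → FP.any? (λ b′ → (b ∈? B) ×-dec (b′ ∈? B) ×-dec ¬? ((b - b′) ∈? B)))
  ... | yes escape = inj₂ escape
  ... | no none = inj₁ λ {b} {b′} b∈B b′∈B →
    decidable-stable ((b - b′) ∈? B) (λ b-b′∉B → none (b , b′ , b∈B , b′∈B , b-b′∉B))

  difference-closed⇒period : ∀ {B} → ε ∈ B → (∀ {b b′} → b ∈ B → b′ ∈ B → b - b′ ∈ B) →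
                             ∀ {b} → b ∈ B → InPeriod G B b
  difference-closed⇒period {B} ε∈B closed {b} b∈B x = into , onto
    where
    into : InTranslate G B b x → x ∈ B
    into (c , c∈B , x≡c∙b) = subst (_∈ B) (sym (begin
      x                  ≡⟨ x≡c∙b ⟩
      c ∙ b              ≡⟨ cong (c ∙_) (⁻¹-involutive b) ⟨
      c - b ⁻¹           ≡⟨ cong (λ y → c - y) (identityˡ (b ⁻¹)) ⟨
      c - (ε - b)        ∎)) (closed c∈B (closed ε∈B b∈B))
    onto : x ∈ B → InTranslate G B b x
    onto x∈B = x - b , closed x∈B b∈B , sym (//-rightDividesˡ b x)

  -- Translates

  infixl 6 _⊖_
  _⊖_ : Subset n → Fin n → Subset n
  A ⊖ a = tabulate (λ x → lookup A (x ∙ a))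

  ∈⊖⁺ : ∀ {A a x} → x ∙ a ∈ A → x ∈ A ⊖ a
  ∈⊖⁺ {A} {a} {x} x∙a∈A =
    VP.lookup⇒[]= x (A ⊖ a) (trans (VP.lookup∘tabulate _ x) (VP.[]=⇒lookup x∙a∈A))

  ∈⊖⁻ : ∀ {A a x} → x ∈ A ⊖ a → x ∙ a ∈ A
  ∈⊖⁻ {A} {a} {x} x∈A⊖a =
    VP.lookup⇒[]= (x ∙ a) A (trans (sym (VP.lookup∘tabulate _ x)) (VP.[]=⇒lookup x∈A⊖a))

  -∈⊖ : ∀ {A a x} → x ∈ A → x - a ∈ A ⊖ a
  -∈⊖ {A} {a} {x} x∈A = ∈⊖⁺ (subst (_∈ A) (sym (//-rightDividesˡ a x)) x∈A)

  ε∈⊖ : ∀ {A a} → a ∈ A → ε ∈ A ⊖ a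
  ε∈⊖ {A} {a} a∈A = ∈⊖⁺ (subst (_∈ A) (sym (identityˡ a)) a∈A)

  ∣⊖∣ : ∀ A a → ∣ A ⊖ a ∣ ≡ ∣ A ∣
  ∣⊖∣ A a = begin
    ∣ A ⊖ a ∣
      ≡⟨ ∣p∣≡∑indicator (A ⊖ a) ⟩
    ℕSum.sum {n} (indicator ∘ lookup (A ⊖ a))
      ≡⟨ ℕSum.sum-cong-≗ (cong indicator ∘ VP.lookup∘tabulate (λ x → lookup A (x ∙ a))) ⟩
    ℕSum.sum {n} (λ x → indicator (lookup A (x ∙ a)))
      ≡⟨ ℕSum.sum-permute (indicator ∘ lookup A) (translation a) ⟨
    ℕSum.sum {n} (indicator ∘ lookup A)
      ≡⟨ ∣p∣≡∑indicator A ⟨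
    ∣ A ∣
      ∎

  ⊖-aperiodic : ∀ {A} a → Aperiodic G A → Aperiodic G (A ⊖ a)
  ⊖-aperiodic {A} a aperiodic g period = aperiodic g λ x → into x , onto x
    where
    into : ∀ x → InTranslate G A g x → x ∈ A
    into x (b , b∈A , x≡b∙g) = subst (_∈ A) (begin
      (b - a) ∙ g ∙ a   ≡⟨ xy∙z≈xz∙y (b - a) g a ⟩
      (b - a) ∙ a ∙ g   ≡⟨ cong (_∙ g) (//-rightDividesˡ a b) ⟩
      b ∙ g             ≡⟨ x≡b∙g ⟨
      x                 ∎) (∈⊖⁻ (proj₁ (period _) (b - a , -∈⊖ b∈A , refl)))
    onto : ∀ x → x ∈ A → InTranslate G A g x
    onto x x∈A with proj₂ (period (x - a)) (-∈⊖ x∈A)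
    ... | c , c∈A⊖a , x-a≡c∙g = c ∙ a , ∈⊖⁻ c∈A⊖a , (begin
      x                 ≡⟨ //-rightDividesˡ a x ⟨
      (x - a) ∙ a       ≡⟨ cong (_∙ a) x-a≡c∙g ⟩
      c ∙ g ∙ a         ≡⟨ xy∙z≈xz∙y c g a ⟩
      c ∙ a ∙ g         ∎)

  ⊖-N-set : ∀ {k A} a → NCond G k A → NCond G k (A ⊖ a)
  ⊖-N-set {k} {A} a (aperiodic , not-full , maximal) =
    ⊖-aperiodic a aperiodic ,
    not-full ∘ MulFull-translate ∈⊖⁻ k ,
    λ g g∉A⊖a → MulFull-translate (shift g) k (maximal (g ∙ a) (g∉A⊖a ∘ ∈⊖⁺))
    where
    shift : ∀ g {c} → c ∈ A ∪ ⁅ g ∙ a ⁆ → c - a ∈ (A ⊖ a) ∪ ⁅ g ⁆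
    shift g {c} c∈ with x∈p∪q⁻ A ⁅ g ∙ a ⁆ c∈
    ... | inj₁ c∈A = p⊆p∪q ⁅ g ⁆ (-∈⊖ c∈A)
    ... | inj₂ c∈⁅g∙a⁆ = q⊆p∪q (A ⊖ a) ⁅ g ⁆
      (subst (_∈ ⁅ g ⁆) (sym (trans (cong (_- a) (x∈⁅y⁆⇒x≡y _ c∈⁅g∙a⁆)) (//-rightDividesʳ a g)))
             (x∈⁅x⁆ g))

  -- T-sets and N-sets

  ε∈T-set : ∀ {k A} → TCond G (suc k) A → ε ∈ A
  ε∈T-set {k} {A} (_ , _ , not-full , maximal) with ε ∈? A
  ... | yes ε∈A = ε∈A
  ... | no ε∉A = contradiction (MulFull-mono (∪-least id (q⊆p∪q A ⁅ ε ⁆)) k (maximal ε ε∉A)) not-full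

  T-set⇒N-set : ∀ {k A} → TCond G (suc k) A → NCond G k A
  T-set⇒N-set {k} {A} T@(aperiodic , _ , not-full , maximal) =
    aperiodic ,
    not-full ∘ MulFull-mono (p⊆p∪q ⁅ ε ⁆) k ,
    λ g g∉A → MulFull-mono (∪-monoˡ-⊆ (∪-least id (x∈p⇒⁅x⁆⊆p (ε∈T-set T)))) k (maximal g g∉A)

  N-set∋ε⇒T-set : ∀ {k B} → Generating G B → ε ∈ B → NCond G k B → TCond G (suc k) B
  N-set∋ε⇒T-set {k} {B} generating ε∈B (aperiodic , not-full , maximal) =
    aperiodic , generating ,
    not-full ∘ MulFull-mono (∪-least id (x∈p⇒⁅x⁆⊆p ε∈B)) k ,
    λ g g∉B → MulFull-mono (∪-monoˡ-⊆ (p⊆p∪q ⁅ ε ⁆)) k (maximal g g∉B)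

  powers-cover⇒exceptional : ∀ {k g₀} → g₀ ≢ ε →
                             (∀ g → g ≢ ε → ∀ x → ∃[ j ] (j ≤ k × x ≡ j · g)) →
                             Prime n × n ∸ 1 ≤ k
  powers-cover⇒exceptional {k} {g₀} g₀≢ε cover =
    all-generators⇒prime g₀≢ε (λ g g≢ε x → let j , _ , x≡j·g = cover g g≢ε x in j , x≡j·g) ,
    ℕP.∸-monoˡ-≤ 1 (powers-cover⇒n≤ λ x → let j , j≤k , x≡j·g₀ = cover g₀ g₀≢ε x in j , s≤s j≤k , x≡j·g₀)

  trivial-N-set⇒exceptional : ∀ {k B} → ε ∈ B → B ⊆ ⁅ ε ⁆ → NCond G k B → Prime n × n ∸ 1 ≤ k
  trivial-N-set⇒exceptional {k} {B} ε∈B B⊆ε (_ , not-full , maximal) with ⊆⁅ε⁆⊎nonidentity ⊤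
  ... | inj₁ ⊤⊆ε = contradiction
    (λ x → subst (InMul G k B) (sym (x∈⁅y⁆⇒x≡y ε (⊤⊆ε ∈⊤))) (ε∈InMul ε∈B k)) not-full
  ... | inj₂ (g₀ , _ , g₀≢ε) = powers-cover⇒exceptional g₀≢ε λ g g≢ε x →
    InMul⊆powers (∪-monoˡ-⊆ B⊆ε) k (maximal g (g≢ε ∘ x∈⁅y⁆⇒x≡y ε ∘ B⊆ε) x)

  -- If a difference b - b′ of elements of B lies outside B, maximality gives k(B ∪ {b - b′}) = G,
  -- which lies in ⟨B⟩. Otherwise B is a subgroup, so each of its elements is a period of B.
  N-set∋ε-generating : ∀ {k B} → ¬ (Prime n × n ∸ 1 ≤ k) → ε ∈ B → NCond G k B → Generating G B
  N-set∋ε-generating {k} {B} non-exceptional ε∈B N@(aperiodic , _ , maximal)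
    with difference-closed⊎escape B
  ... | inj₂ (b , b′ , b∈B , b′∈B , b-b′∉B) = λ x → InMul⇒InGen ∈⟨B⟩ k (maximal (b - b′) b-b′∉B x)
    where
    ∈⟨B⟩ : ∀ {c} → c ∈ B ∪ ⁅ b - b′ ⁆ → InGen G B c
    ∈⟨B⟩ {c} c∈ with x∈p∪q⁻ B ⁅ b - b′ ⁆ c∈
    ... | inj₁ c∈B = gen-el c∈B
    ... | inj₂ c∈⁅b-b′⁆ =
      subst (InGen G B) (sym (x∈⁅y⁆⇒x≡y _ c∈⁅b-b′⁆)) (gen-op (gen-el b∈B) (gen-inv (gen-el b′∈B)))
  ... | inj₁ closed = contradiction (trivial-N-set⇒exceptional ε∈B B⊆ε N) non-exceptional
    where
    B⊆ε : B ⊆ ⁅ ε ⁆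
    B⊆ε b∈B = subst (_∈ ⁅ ε ⁆) (sym (aperiodic _ (difference-closed⇒period ε∈B closed b∈B))) (x∈⁅x⁆ ε)

  N-set⇒T-set : ∀ {k A a} → ¬ (Prime n × n ∸ 1 ≤ k) → NCond G k A → a ∈ A → TCond G (suc k) (A ⊖ a)
  N-set⇒T-set {k} {A} {a} non-exceptional N a∈A =
    N-set∋ε⇒T-set (N-set∋ε-generating non-exceptional (ε∈⊖ a∈A) N⊖a) (ε∈⊖ a∈A) N⊖a
    where
    N⊖a : NCond G k (A ⊖ a)
    N⊖a = ⊖-N-set a N

  module Exceptional {k} (p : Prime n) (n∸1≤k : n ∸ 1 ≤ k) where

    full-from-nonidentity : ∀ {C c} → ε ∈ C → c ∈ C → c ≢ ε → MulFull G k C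
    full-from-nonidentity {C} {c} ε∈C c∈C c≢ε x with prime⇒generator p c≢ε x
    ... | j , j<n , x≡j·c =
      subst (InMul G k C) (sym x≡j·c) (·∈InMul ε∈C c∈C (ℕP.≤-trans (ℕP.∸-monoˡ-≤ 1 j<n) n∸1≤k))

    no-T-set : ∀ {A} → ¬ TCond G (suc k) A
    no-T-set {A} (_ , generating , not-full , _) with ⊆⁅ε⁆⊎nonidentity A
    ... | inj₁ A⊆ε = prime⇒nontrivial p (λ x → InGen-⊆⁅ε⁆ A⊆ε (generating x))
    ... | inj₂ (a , a∈A , a≢ε) =
      not-full (full-from-nonidentity (q⊆p∪q A ⁅ ε ⁆ (x∈⁅x⁆ ε)) (p⊆p∪q ⁅ ε ⁆ a∈A) a≢ε)

    ⁅ε⁆-N-set : NCond G k ⁅ ε ⁆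
    ⁅ε⁆-N-set = aperiodic , not-full , maximal
      where
      aperiodic : Aperiodic G ⁅ ε ⁆
      aperiodic g period with proj₂ (period ε) (x∈⁅x⁆ ε)
      ... | c , c∈⁅ε⁆ , ε≡c∙g = sym (begin
        ε       ≡⟨ ε≡c∙g ⟩
        c ∙ g   ≡⟨ cong (_∙ g) (x∈⁅y⁆⇒x≡y ε c∈⁅ε⁆) ⟩
        ε ∙ g   ≡⟨ identityˡ g ⟩
        g       ∎)
      not-full : ¬ MulFull G k ⁅ ε ⁆
      not-full full = prime⇒nontrivial p λ x →
        let j , _ , x≡j·ε = InMul⊆powers (p⊆p∪q ⁅ ε ⁆) k (full x) in trans x≡j·ε (·-ε j)
      maximal : ∀ g → g ∉ ⁅ ε ⁆ → MulFull G k (⁅ ε ⁆ ∪ ⁅ g ⁆)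
      maximal g g∉⁅ε⁆ = full-from-nonidentity (p⊆p∪q ⁅ g ⁆ (x∈⁅x⁆ ε)) (q⊆p∪q ⁅ ε ⁆ ⁅ g ⁆ (x∈⁅x⁆ g))
        (λ g≡ε → g∉⁅ε⁆ (subst (_∈ ⁅ ε ⁆) (sym g≡ε) (x∈⁅x⁆ ε)))

    N-set-size≤1 : ∀ {A} → NCond G k A → ∣ A ∣ ≤ 1
    N-set-size≤1 {A} N = bound-if-nonempty size≤1
      where
      size≤1 : ∀ {a} → a ∈ A → ∣ A ∣ ≤ 1
      size≤1 {a} a∈A with ⊖-N-set a N | ⊆⁅ε⁆⊎nonidentity (A ⊖ a)
      ... | _ | inj₁ A⊖a⊆ε = subst₂ _≤_ (∣⊖∣ A a) (∣⁅x⁆∣≡1 ε) (p⊆q⇒∣p∣≤∣q∣ A⊖a⊆ε)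
      ... | _ , not-full , _ | inj₂ (c , c∈A⊖a , c≢ε) =
        contradiction (full-from-nonidentity (ε∈⊖ a∈A) c∈A⊖a c≢ε) not-full

lemma5 : (n : ℕ) (G : FinAbGroup n) (k : ℕ) → 1 ≤ k → (t N : ℕ)
    → IsLargest (TCond G (suc k)) t → IsLargest (NCond G k) N
    → ((Prime n × n ∸ 1 ≤ k) → (t ≡ 0 × N ≡ 1))
    × (¬ (Prime n × n ∸ 1 ≤ k) → t ≡ N)
lemma5 n G k _ t N t-largest N-largest = exceptional , non-exceptional
  where
  open FinAbGroup G using (ε)
  open Properties G

  exceptional : Prime n × n ∸ 1 ≤ k → t ≡ 0 × N ≡ 1
  exceptional (p , n∸1≤k) =
    largest-unsatisfiable t-largest (λ _ → no-T-set) ,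
    ℕP.≤-antisym (largest-≤ N-largest (λ _ → N-set-size≤1))
                 (subst (_≤ N) (∣⁅x⁆∣≡1 ε) (proj₂ N-largest ⁅ ε ⁆ ⁅ε⁆-N-set))
    where open Exceptional p n∸1≤k

  non-exceptional : ¬ (Prime n × n ∸ 1 ≤ k) → t ≡ N
  non-exceptional ¬exceptional = ℕP.≤-antisym
    (largest-≤ t-largest λ A T → proj₂ N-largest A (T-set⇒N-set T))
    (largest-≤ N-largest λ A N → bound-if-nonempty λ {a} a∈A →
      subst (_≤ t) (∣⊖∣ A a) (proj₂ t-largest (A ⊖ a) (N-set⇒T-set ¬exceptional N a∈A)))
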